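{- Let $A$ be a Heyting algebra and let $B$ be a Brouwerian subalgebra of $A^+$. Then every homomorphic image of $B$ (as a Brouwerian algebra) is isomorphic to a Brouwerian subalgebra of $C^+$ for some homomorphic image $C$ of the Heyting algebra $A$.
   Context: A Brouwerian algebra is an algebra $(A,\land,\lor,\to,1)$ in which $(A,\land,\lor)$ is a distributive lattice with top $1$ and $\to$ is relative pseudo-complementation. A Heyting algebra additionally has a constant $0$ which is the least element. For a Heyting algebra $A$, $A^+$ denotes its $\{\land,\lor,\to,1\}$-reduct. -}

module Defs where

open import Level using (Level; _⊔_) renaming (suc to lsuc)
open import Data.Product using (Σ; Σ-syntax; ∃; _,_; proj₁; proj₂; _×_)
open import Relation.Unary using (Pred; _∈_)
open import Relation.Binary using (Rel; IsEquivalence)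
open import Algebra.Core using (Op₂)
open import Algebra.Lattice.Bundles using (DistributiveLattice)
open import Algebra.Lattice.Structures using (IsLattice; IsDistributiveLattice)

record Brouwerian (c ℓ : Level) : Set (lsuc (c ⊔ ℓ)) where
  field
    distributiveLattice : DistributiveLattice c ℓ
  open DistributiveLattice distributiveLattice public
  infix 4 _≤_
  _≤_ : Rel Carrier ℓ
  x ≤ y = (x ∧ y) ≈ x
  infixr 5 _⇒_
  field
    _⇒_    : Op₂ Carrier
    ⊤      : Carrier
    ⇒-cong : ∀ {x x′ y y′} → x ≈ x′ → y ≈ y′ → (x ⇒ y) ≈ (x′ ⇒ y′)
    ⊤-max  : ∀ x → x ≤ ⊤
    residual→ : ∀ x a b → (x ∧ a) ≤ b → x ≤ (a ⇒ b)
    residual← : ∀ x a b → x ≤ (a ⇒ b) → (x ∧ a) ≤ b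

record Heyting (c ℓ : Level) : Set (lsuc (c ⊔ ℓ)) where
  field
    brouwerian : Brouwerian c ℓ
  open Brouwerian brouwerian public
  field
    ⊥     : Carrier
    ⊥-min : ∀ x → ⊥ ≤ x

_⁺ : ∀ {c ℓ} → Heyting c ℓ → Brouwerian c ℓ
A ⁺ = Heyting.brouwerian A

module _ {a ℓa b ℓb} (A : Brouwerian a ℓa) (B : Brouwerian b ℓb) where
  private
    module A = Brouwerian A
    module B = Brouwerian B

  record BrouwerianHom : Set (a ⊔ ℓa ⊔ b ⊔ ℓb) where
    field
      ⟦_⟧    : A.Carrier → B.Carrier
      cong   : ∀ {x y} → x A.≈ y → ⟦ x ⟧ B.≈ ⟦ y ⟧
      ∧-homo : ∀ x y → ⟦ x A.∧ y ⟧ B.≈ (⟦ x ⟧ B.∧ ⟦ y ⟧)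
      ∨-homo : ∀ x y → ⟦ x A.∨ y ⟧ B.≈ (⟦ x ⟧ B.∨ ⟦ y ⟧)
      ⇒-homo : ∀ x y → ⟦ x A.⇒ y ⟧ B.≈ (⟦ x ⟧ B.⇒ ⟦ y ⟧)
      ⊤-homo : ⟦ A.⊤ ⟧ B.≈ B.⊤

  Surjective : (f : A.Carrier → B.Carrier) → Set (a ⊔ b ⊔ ℓb)
  Surjective f = ∀ y → ∃ λ x → f x B.≈ y

  Injective : (f : A.Carrier → B.Carrier) → Set (a ⊔ ℓa ⊔ ℓb)
  Injective f = ∀ {x y} → f x B.≈ f y → x A.≈ y

  record BrouwerianIso : Set (a ⊔ ℓa ⊔ b ⊔ ℓb) where
    field
      hom         : BrouwerianHom
    open BrouwerianHom hom public
    field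
      injective  : Injective ⟦_⟧
      surjective : Surjective ⟦_⟧

  record BrouwerianHomImage : Set (a ⊔ ℓa ⊔ b ⊔ ℓb) where
    field
      hom        : BrouwerianHom
      surjective : Surjective (BrouwerianHom.⟦_⟧ hom)

module _ {a ℓa b ℓb} (A : Heyting a ℓa) (B : Heyting b ℓb) where
  private
    module A = Heyting A
    module B = Heyting B

  record HeytingHom : Set (a ⊔ ℓa ⊔ b ⊔ ℓb) where
    field
      brouwerianHom : BrouwerianHom (A ⁺) (B ⁺)
    open BrouwerianHom brouwerianHom public
    field
      ⊥-homo : ⟦ A.⊥ ⟧ B.≈ B.⊥

  record HeytingHomImage : Set (a ⊔ ℓa ⊔ b ⊔ ℓb) where
    field
      hom        : HeytingHom
      surjective : Surjective (A ⁺) (B ⁺) (HeytingHom.⟦_⟧ hom)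

record Subalgebra {c ℓ} (A : Brouwerian c ℓ) (p : Level) : Set (c ⊔ lsuc p) where
  open Brouwerian A
  field
    P       : Pred Carrier p
    ∧-closed : ∀ {x y} → x ∈ P → y ∈ P → (x ∧ y) ∈ P
    ∨-closed : ∀ {x y} → x ∈ P → y ∈ P → (x ∨ y) ∈ P
    ⇒-closed : ∀ {x y} → x ∈ P → y ∈ P → (x ⇒ y) ∈ P
    ⊤-closed : ⊤ ∈ P

⟪_⟫ : ∀ {c ℓ p} {A : Brouwerian c ℓ} → Subalgebra A p → Brouwerian (c ⊔ p) ℓ
⟪_⟫ {c} {ℓ} {p} {A} S = record
  { distributiveLattice = record
      { Carrier = Carrier′
      ; _≈_ = _≈′_
      ; _∨_ = _∨′_
      ; _∧_ = _∧′_
      ; isDistributiveLattice = record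
          { isLattice = record
              { isEquivalence = record { refl = refl ; sym = sym ; trans = trans }
              ; ∨-comm = λ x y → ∨-comm (proj₁ x) (proj₁ y)
              ; ∨-assoc = λ x y z → ∨-assoc (proj₁ x) (proj₁ y) (proj₁ z)
              ; ∨-cong = ∨-cong
              ; ∧-comm = λ x y → ∧-comm (proj₁ x) (proj₁ y)
              ; ∧-assoc = λ x y z → ∧-assoc (proj₁ x) (proj₁ y) (proj₁ z)
              ; ∧-cong = ∧-cong
              ; absorptive = (λ x y → ∨-absorbs-∧ (proj₁ x) (proj₁ y))
                           , (λ x y → ∧-absorbs-∨ (proj₁ x) (proj₁ y))
              }
          ; ∨-distrib-∧ = (λ x y z → ∨-distribˡ-∧ (proj₁ x) (proj₁ y) (proj₁ z))
                        , (λ x y z → ∨-distribʳ-∧ (proj₁ x) (proj₁ y) (proj₁ z))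
          ; ∧-distrib-∨ = (λ x y z → ∧-distribˡ-∨ (proj₁ x) (proj₁ y) (proj₁ z))
                        , (λ x y z → ∧-distribʳ-∨ (proj₁ x) (proj₁ y) (proj₁ z))
          }
      }
  ; _⇒_ = λ x y → (proj₁ x ⇒ proj₁ y) , ⇒-closed (proj₂ x) (proj₂ y)
  ; ⊤ = ⊤ , ⊤-closed
  ; ⇒-cong = ⇒-cong
  ; ⊤-max = λ x → ⊤-max (proj₁ x)
  ; residual→ = λ x a b → residual→ (proj₁ x) (proj₁ a) (proj₁ b)
  ; residual← = λ x a b → residual← (proj₁ x) (proj₁ a) (proj₁ b)
  }
  where
  open Brouwerian A
  open Subalgebra S
  Carrier′ : Set (c ⊔ p)
  Carrier′ = Σ Carrier P
  _≈′_ : Rel Carrier′ ℓ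
  x ≈′ y = proj₁ x ≈ proj₁ y
  _∨′_ _∧′_ : Op₂ Carrier′
  x ∨′ y = (proj₁ x ∨ proj₁ y) , ∨-closed (proj₂ x) (proj₂ y)
  x ∧′ y = (proj₁ x ∧ proj₁ y) , ∧-closed (proj₂ x) (proj₂ y)

module Submission where

-- Let h : ⟪ B ⟫ ↠ D.  Its kernel {b ∈ B | h b ≈ ⊤} is closed under ∧
-- and contains ⊤, so it generates the congruence θ on A given by
--   x θ y  ⇔  f ∧ x ≈ f ∧ y  for some f in the kernel.
-- Take C = A/θ and S = B viewed inside C.  For u, v ∈ B we have u θ v iff
-- h u ≈ h v (the witness for ⇐ is the biimplication (u⇒v) ∧ (v⇒u)), so the
-- surjections h : ⟪ B ⟫ ↠ D and ⟪ B ⟫ ↠ ⟪ S ⟫ have the same kernel, whence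
-- D ≅ ⟪ S ⟫.

open import Defs
open import Level using (Level; _⊔_; Lift; lift; lower) renaming (suc to lsuc)
open import Data.Product using (Σ-syntax; _,_; proj₁; proj₂; _×_)
open import Algebra.Bundles using (CommutativeSemigroup)
open import Algebra.Core using (Op₂)
open import Relation.Binary using (Rel; IsEquivalence; Setoid)
open import Relation.Unary using (Pred; _∈_)
import Relation.Binary.Reasoning.Setoid as SetoidReasoning
import Relation.Binary.Bundles

module BrouwerianArithmetic {c ℓ} (X : Brouwerian c ℓ) where
  open Brouwerian X hiding (_≤_)
  open import Algebra.Lattice.Properties.Lattice lattice
    using (∧-idem; ∧-isSemigroup; ∨-∧-orderTheoreticLattice)
  open SetoidReasoning setoid

  private
    ∧-commutativeSemigroup : CommutativeSemigroup c ℓ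
    ∧-commutativeSemigroup = record
      { isCommutativeSemigroup = record { isSemigroup = ∧-isSemigroup ; comm = ∧-comm } }

  open import Algebra.Properties.CommutativeSemigroup ∧-commutativeSemigroup public
    using (interchange; xy∙z≈y∙zx; x∙yz≈y∙zx; x∙yz≈xz∙y)

  private
    open import Relation.Binary.Lattice using (module Lattice)
    open import Relation.Binary.Lattice.Properties.MeetSemilattice
      (Lattice.meetSemilattice ∨-∧-orderTheoreticLattice) using (∧-monotonic)
    open Lattice ∨-∧-orderTheoreticLattice using (_≤_; poset; x∧y≤x; x∧y≤y; ∧-greatest)
    module ≤ = Relation.Binary.Bundles.Poset poset

  -- In the order x ≤ y ⇔ x ≈ x ∧ y (the symmetric form of the one in Defs)
  -- the Brouwerian axioms say: ⊤ is greatest and _⇒_ is right adjoint to _∧_.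
  private
    ≤-⊤ : ∀ x → x ≤ ⊤
    ≤-⊤ x = sym (⊤-max x)

    ⇒-intro : ∀ {x a b} → x ∧ a ≤ b → x ≤ a ⇒ b
    ⇒-intro p = sym (residual→ _ _ _ (sym p))

    ⇒-elim : ∀ {a b} → (a ⇒ b) ∧ a ≤ b
    ⇒-elim {a} {b} = sym (residual← (a ⇒ b) a b (∧-idem (a ⇒ b)))

  ⇒-diag : ∀ a → a ⇒ a ≈ ⊤
  ⇒-diag a = ≤.antisym (≤-⊤ (a ⇒ a)) (⇒-intro (x∧y≤y ⊤ a))

  ∧-⇒ : ∀ a b → a ∧ (a ⇒ b) ≈ a ∧ b
  ∧-⇒ a b = ≤.antisym
    (∧-greatest (x∧y≤x a (a ⇒ b)) (≤.trans (≤.reflexive (∧-comm a (a ⇒ b))) ⇒-elim))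
    (∧-greatest (x∧y≤x a b) (⇒-intro (≤.trans (x∧y≤x (a ∧ b) a) (x∧y≤y a b))))

  ⇒-∧ : ∀ a b → a ⇒ b ≈ a ⇒ (a ∧ b)
  ⇒-∧ a b = ≤.antisym
    (⇒-intro (∧-greatest (x∧y≤y (a ⇒ b) a) ⇒-elim))
    (⇒-intro (≤.trans ⇒-elim (x∧y≤y a b)))

  ∧-⇒-restrict : ∀ h a b → h ∧ (a ⇒ b) ≈ h ∧ ((h ∧ a) ⇒ b)
  ∧-⇒-restrict h a b = ≤.antisym
    (∧-greatest (x∧y≤x h (a ⇒ b))
      (⇒-intro (≤.trans (∧-monotonic (x∧y≤y h (a ⇒ b)) (x∧y≤y h a)) ⇒-elim)))
    (∧-greatest (x∧y≤x h _)
      (⇒-intro (≤.trans (∧-greatest (≤.trans (x∧y≤x _ a) (x∧y≤y h _))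
                                    (∧-monotonic (x∧y≤x h _) ≤.refl))
                        ⇒-elim)))

  -- x and y agree below h; the congruences we build are "agree below some
  -- element of a filter".
  AgreeBelow : Carrier → Carrier → Carrier → Set ℓ
  AgreeBelow h x y = h ∧ x ≈ h ∧ y

  ∧-below : ∀ h x y → h ∧ (x ∧ y) ≈ (h ∧ x) ∧ (h ∧ y)
  ∧-below h x y = begin
    h ∧ (x ∧ y)        ≈⟨ ∧-cong (∧-idem h) refl ⟨
    (h ∧ h) ∧ (x ∧ y)  ≈⟨ interchange h h x y ⟩
    (h ∧ x) ∧ (h ∧ y)  ∎

  ⇒-below : ∀ h x y → h ∧ (x ⇒ y) ≈ h ∧ ((h ∧ x) ⇒ (h ∧ y))
  ⇒-below h x y = begin
    h ∧ (x ⇒ y)                          ≈⟨ ∧-⇒-restrict h x y ⟩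
    h ∧ ((h ∧ x) ⇒ y)                    ≈⟨ ∧-cong refl (⇒-∧ (h ∧ x) y) ⟩
    h ∧ ((h ∧ x) ⇒ ((h ∧ x) ∧ y))        ≈⟨ ∧-cong refl (⇒-cong refl hx∧y) ⟩
    h ∧ ((h ∧ x) ⇒ ((h ∧ x) ∧ (h ∧ y)))  ≈⟨ ∧-cong refl (⇒-∧ (h ∧ x) (h ∧ y)) ⟨
    h ∧ ((h ∧ x) ⇒ (h ∧ y))              ∎
    where
    hx∧y : (h ∧ x) ∧ y ≈ (h ∧ x) ∧ (h ∧ y)
    hx∧y = trans (∧-assoc h x y) (∧-below h x y)

  agree-∧ : ∀ {h x x′ y y′} → AgreeBelow h x x′ → AgreeBelow h y y′
          → AgreeBelow h (x ∧ y) (x′ ∧ y′)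
  agree-∧ {h} {x} {x′} {y} {y′} p q =
    trans (∧-below h x y) (trans (∧-cong p q) (sym (∧-below h x′ y′)))

  agree-∨ : ∀ {h x x′ y y′} → AgreeBelow h x x′ → AgreeBelow h y y′
          → AgreeBelow h (x ∨ y) (x′ ∨ y′)
  agree-∨ {h} {x} {x′} {y} {y′} p q =
    trans (∧-distribˡ-∨ h x y) (trans (∨-cong p q) (sym (∧-distribˡ-∨ h x′ y′)))

  agree-⇒ : ∀ {h x x′ y y′} → AgreeBelow h x x′ → AgreeBelow h y y′
          → AgreeBelow h (x ⇒ y) (x′ ⇒ y′)
  agree-⇒ {h} {x} {x′} {y} {y′} p q =
    trans (⇒-below h x y) (trans (∧-cong refl (⇒-cong p q)) (sym (⇒-below h x′ y′)))

  agree-shrinkʳ : ∀ {f g x y} → AgreeBelow g x y → AgreeBelow (f ∧ g) x y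
  agree-shrinkʳ {f} {g} {x} {y} p =
    trans (∧-assoc f g x) (trans (∧-cong refl p) (sym (∧-assoc f g y)))

  agree-shrinkˡ : ∀ {f g x y} → AgreeBelow f x y → AgreeBelow (f ∧ g) x y
  agree-shrinkˡ {f} {g} p =
    trans (∧-cong (∧-comm f g) refl) (trans (agree-shrinkʳ p) (∧-cong (∧-comm g f) refl))

  agree-⇔ : ∀ a b → AgreeBelow ((a ⇒ b) ∧ (b ⇒ a)) a b
  agree-⇔ a b = begin
    ((a ⇒ b) ∧ (b ⇒ a)) ∧ a  ≈⟨ ⇔∧ a b ⟩
    a ∧ b                    ≈⟨ ∧-comm a b ⟩
    b ∧ a                    ≈⟨ ⇔∧ b a ⟨
    ((b ⇒ a) ∧ (a ⇒ b)) ∧ b  ≈⟨ ∧-cong (∧-comm (b ⇒ a) (a ⇒ b)) refl ⟩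
    ((a ⇒ b) ∧ (b ⇒ a)) ∧ b  ∎
    where
    ⇔∧ : ∀ a b → ((a ⇒ b) ∧ (b ⇒ a)) ∧ a ≈ a ∧ b
    ⇔∧ a b = begin
      ((a ⇒ b) ∧ (b ⇒ a)) ∧ a  ≈⟨ xy∙z≈y∙zx (a ⇒ b) (b ⇒ a) a ⟩
      (b ⇒ a) ∧ (a ∧ (a ⇒ b))  ≈⟨ ∧-cong refl (∧-⇒ a b) ⟩
      (b ⇒ a) ∧ (a ∧ b)        ≈⟨ x∙yz≈y∙zx (b ⇒ a) a b ⟩
      a ∧ (b ∧ (b ⇒ a))        ≈⟨ ∧-cong refl (∧-⇒ b a) ⟩
      a ∧ (b ∧ a)              ≈⟨ ∧-cong refl (∧-comm b a) ⟩
      a ∧ (a ∧ b)              ≈⟨ ∧-assoc a a b ⟨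
      (a ∧ a) ∧ b              ≈⟨ ∧-cong (∧-idem a) refl ⟩
      a ∧ b                    ∎

record Congruence {c ℓ} (X : Brouwerian c ℓ) (r : Level) : Set (c ⊔ ℓ ⊔ lsuc r) where
  open Brouwerian X using (Carrier; _≈_; _∧_; _∨_; _⇒_)
  infix 4 _≋_
  field
    _≋_           : Rel Carrier r
    isEquivalence : IsEquivalence _≋_
    ≈⇒≋           : ∀ {x y} → x ≈ y → x ≋ y
    ∧-compat      : ∀ {x x′ y y′} → x ≋ x′ → y ≋ y′ → x ∧ y ≋ x′ ∧ y′
    ∨-compat      : ∀ {x x′ y y′} → x ≋ x′ → y ≋ y′ → x ∨ y ≋ x′ ∨ y′
    ⇒-compat      : ∀ {x x′ y y′} → x ≋ x′ → y ≋ y′ → x ⇒ y ≋ x′ ⇒ y′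

  open IsEquivalence isEquivalence public
    using () renaming (refl to ≋-refl; sym to ≋-sym; trans to ≋-trans)

  ≋-setoid : Setoid c r
  ≋-setoid = record { isEquivalence = isEquivalence }

-- The quotient X/θ, with carrier and equality lifted to an arbitrary level l
-- (the theorem asks for the quotient in a prescribed universe).  Its lattice
-- laws are those of X; residuation holds because ⇒ is expressible by
-- equations (∧-⇒, ⇒-∧, ∧-⇒-restrict, ⇒-diag) that a congruence respects.
module Quotient {c ℓ r} {X : Brouwerian c ℓ} (θ : Congruence X r) (l : Level) where
  open Brouwerian X hiding (isEquivalence)
  open Congruence θ
  open BrouwerianArithmetic X using (⇒-diag; ∧-⇒; ⇒-∧; ∧-⇒-restrict; x∙yz≈xz∙y)

  ≋-residual→ : ∀ x a b → (x ∧ a) ∧ b ≋ x ∧ a → x ∧ (a ⇒ b) ≋ x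
  ≋-residual→ x a b p = begin
    x ∧ (a ⇒ b)                        ≈⟨ ≈⇒≋ (∧-⇒-restrict x a b) ⟩
    x ∧ ((x ∧ a) ⇒ b)                  ≈⟨ ≈⇒≋ (∧-cong refl (⇒-∧ (x ∧ a) b)) ⟩
    x ∧ ((x ∧ a) ⇒ ((x ∧ a) ∧ b))      ≈⟨ ∧-compat ≋-refl (⇒-compat ≋-refl p) ⟩
    x ∧ ((x ∧ a) ⇒ (x ∧ a))            ≈⟨ ≈⇒≋ (∧-cong refl (⇒-diag (x ∧ a))) ⟩
    x ∧ ⊤                              ≈⟨ ≈⇒≋ (⊤-max x) ⟩
    x                                  ∎
    where open SetoidReasoning ≋-setoid

  ≋-residual← : ∀ x a b → x ∧ (a ⇒ b) ≋ x → (x ∧ a) ∧ b ≋ x ∧ a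
  ≋-residual← x a b p = begin
    (x ∧ a) ∧ b            ≈⟨ ≈⇒≋ (trans (∧-assoc x a b) (∧-cong refl (sym (∧-⇒ a b)))) ⟩
    x ∧ (a ∧ (a ⇒ b))      ≈⟨ ≈⇒≋ (x∙yz≈xz∙y x a (a ⇒ b)) ⟩
    (x ∧ (a ⇒ b)) ∧ a      ≈⟨ ∧-compat p ≋-refl ⟩
    x ∧ a                  ∎
    where open SetoidReasoning ≋-setoid

  Q : Set (c ⊔ l)
  Q = Lift l Carrier

  _≈Q_ : Rel Q (r ⊔ l)
  x ≈Q y = Lift l (lower x ≋ lower y)

  _∧Q_ _∨Q_ _⇒Q_ : Op₂ Q
  x ∧Q y = lift (lower x ∧ lower y)
  x ∨Q y = lift (lower x ∨ lower y)
  x ⇒Q y = lift (lower x ⇒ lower y)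

  ≈⇒≈Q : ∀ {x y} → x ≈ y → lift x ≈Q lift y
  ≈⇒≈Q e = lift (≈⇒≋ e)

  quotient : Brouwerian (c ⊔ l) (r ⊔ l)
  quotient = record
    { distributiveLattice = record
      { Carrier = Q ; _≈_ = _≈Q_ ; _∨_ = _∨Q_ ; _∧_ = _∧Q_
      ; isDistributiveLattice = record
        { isLattice = record
          { isEquivalence = record
              { refl  = lift ≋-refl
              ; sym   = λ e → lift (≋-sym (lower e))
              ; trans = λ e f → lift (≋-trans (lower e) (lower f)) }
          ; ∨-comm     = λ _ _ → ≈⇒≈Q (∨-comm _ _)
          ; ∨-assoc    = λ _ _ _ → ≈⇒≈Q (∨-assoc _ _ _)
          ; ∨-cong     = λ e f → lift (∨-compat (lower e) (lower f))
          ; ∧-comm     = λ _ _ → ≈⇒≈Q (∧-comm _ _)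
          ; ∧-assoc    = λ _ _ _ → ≈⇒≈Q (∧-assoc _ _ _)
          ; ∧-cong     = λ e f → lift (∧-compat (lower e) (lower f))
          ; absorptive = (λ _ _ → ≈⇒≈Q (∨-absorbs-∧ _ _)) , (λ _ _ → ≈⇒≈Q (∧-absorbs-∨ _ _))
          }
        ; ∨-distrib-∧ = (λ _ _ _ → ≈⇒≈Q (∨-distribˡ-∧ _ _ _)) , (λ _ _ _ → ≈⇒≈Q (∨-distribʳ-∧ _ _ _))
        ; ∧-distrib-∨ = (λ _ _ _ → ≈⇒≈Q (∧-distribˡ-∨ _ _ _)) , (λ _ _ _ → ≈⇒≈Q (∧-distribʳ-∨ _ _ _))
        }
      }
    ; _⇒_       = _⇒Q_
    ; ⊤         = lift ⊤
    ; ⇒-cong    = λ e f → lift (⇒-compat (lower e) (lower f))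
    ; ⊤-max     = λ _ → ≈⇒≈Q (⊤-max _)
    ; residual→ = λ x a b p → lift (≋-residual→ (lower x) (lower a) (lower b) (lower p))
    ; residual← = λ x a b p → lift (≋-residual← (lower x) (lower a) (lower b) (lower p))
    }

  π : BrouwerianHom X quotient
  π = record
    { ⟦_⟧ = lift ; cong = ≈⇒≈Q
    ; ∧-homo = λ _ _ → lift ≋-refl ; ∨-homo = λ _ _ → lift ≋-refl
    ; ⇒-homo = λ _ _ → lift ≋-refl ; ⊤-homo = lift ≋-refl }

  π-surjective : Surjective X quotient lift
  π-surjective y = lower y , lift ≋-refl

  image : ∀ {p} → Subalgebra X p → Subalgebra quotient (p ⊔ l)
  image B = record
    { P        = λ x → Lift l (P (lower x))
    ; ∧-closed = λ u v → lift (∧-closed (lower u) (lower v))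
    ; ∨-closed = λ u v → lift (∨-closed (lower u) (lower v))
    ; ⇒-closed = λ u v → lift (⇒-closed (lower u) (lower v))
    ; ⊤-closed = lift ⊤-closed }
    where open Subalgebra B

  π↾ : ∀ {p} (B : Subalgebra X p) → BrouwerianHomImage ⟪ B ⟫ ⟪ image B ⟫
  π↾ B = record
    { hom = record
      { ⟦_⟧ = λ (x , px) → lift x , lift px ; cong = ≈⇒≈Q
      ; ∧-homo = λ _ _ → lift ≋-refl ; ∨-homo = λ _ _ → lift ≋-refl
      ; ⇒-homo = λ _ _ → lift ≋-refl ; ⊤-homo = lift ≋-refl }
    ; surjective = λ (x , px) → (lower x , lower px) , lift ≋-refl }

module HeytingQuotient {c ℓ r} (A : Heyting c ℓ) (θ : Congruence (A ⁺) r) (l : Level) where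
  open Heyting A using (⊥; ⊥-min)
  open Congruence θ using (≋-refl)
  open Quotient θ l public

  A/θ : Heyting (c ⊔ l) (r ⊔ l)
  A/θ = record { brouwerian = quotient ; ⊥ = lift ⊥ ; ⊥-min = λ _ → ≈⇒≈Q (⊥-min _) }

  projection : HeytingHomImage A A/θ
  projection = record
    { hom = record { brouwerianHom = π ; ⊥-homo = lift ≋-refl }
    ; surjective = π-surjective }

filterCongruence : ∀ {c ℓ q} (X : Brouwerian c ℓ) (F : Pred (Brouwerian.Carrier X) q)
  → Brouwerian.⊤ X ∈ F → (∀ {f g} → f ∈ F → g ∈ F → Brouwerian._∧_ X f g ∈ F)
  → Congruence X (c ⊔ ℓ ⊔ q)
filterCongruence X F ⊤∈F ∧∈F = record
  { _≋_           = _≋_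
  ; isEquivalence = record
    { refl  = ⊤ , ⊤∈F , refl
    ; sym   = λ (f , f∈F , p) → f , f∈F , sym p
    ; trans = λ (f , f∈F , p) (g , g∈F , q) →
                f ∧ g , ∧∈F f∈F g∈F , trans (agree-shrinkˡ p) (agree-shrinkʳ q) }
  ; ≈⇒≋      = λ e → ⊤ , ⊤∈F , ∧-cong refl e
  ; ∧-compat = compatible agree-∧
  ; ∨-compat = compatible agree-∨
  ; ⇒-compat = compatible agree-⇒
  }
  where
  open Brouwerian X
  open BrouwerianArithmetic X using (AgreeBelow; agree-∧; agree-∨; agree-⇒; agree-shrinkˡ; agree-shrinkʳ)

  _≋_ : Rel Carrier _
  x ≋ y = Σ[ f ∈ Carrier ] f ∈ F × AgreeBelow f x y

  compatible : {_∙_ : Op₂ Carrier}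
    → (∀ {h x x′ y y′} → AgreeBelow h x x′ → AgreeBelow h y y′ → AgreeBelow h (x ∙ y) (x′ ∙ y′))
    → ∀ {x x′ y y′} → x ≋ x′ → y ≋ y′ → (x ∙ y) ≋ (x′ ∙ y′)
  compatible agree (f , f∈F , p) (g , g∈F , q) =
    f ∧ g , ∧∈F f∈F g∈F , agree (agree-shrinkˡ p) (agree-shrinkʳ q)

module Kernel {a ℓ p d ℓd} {A : Brouwerian a ℓ} (B : Subalgebra A p)
              {D : Brouwerian d ℓd} (h : BrouwerianHom ⟪ B ⟫ D) where
  private
    module A = Brouwerian A
    module B = Brouwerian ⟪ B ⟫
    module D = Brouwerian D
    open Subalgebra B using (P; ∧-closed; ⊤-closed)
    open BrouwerianHom h
    open BrouwerianArithmetic using (⇒-diag; agree-⇔)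

  Ker : Pred A.Carrier (p ⊔ ℓd)
  Ker f = Σ[ f∈B ∈ P f ] ⟦ f , f∈B ⟧ D.≈ D.⊤

  θ : Congruence A (a ⊔ ℓ ⊔ p ⊔ ℓd)
  θ = filterCongruence A Ker (⊤-closed , ⊤-homo) λ (f∈B , hf) (g∈B , hg) →
    ∧-closed f∈B g∈B , D.trans (∧-homo _ _) (D.trans (D.∧-cong hf hg) (D.⊤-max D.⊤))

  open Congruence θ using (_≋_)

  ∧-kernel : ∀ f u → ⟦ f ⟧ D.≈ D.⊤ → ⟦ f B.∧ u ⟧ D.≈ ⟦ u ⟧
  ∧-kernel f u hf = begin
    ⟦ f B.∧ u ⟧      ≈⟨ ∧-homo f u ⟩
    ⟦ f ⟧ D.∧ ⟦ u ⟧  ≈⟨ D.∧-cong hf D.refl ⟩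
    D.⊤ D.∧ ⟦ u ⟧    ≈⟨ D.∧-comm D.⊤ ⟦ u ⟧ ⟩
    ⟦ u ⟧ D.∧ D.⊤    ≈⟨ D.⊤-max ⟦ u ⟧ ⟩
    ⟦ u ⟧            ∎
    where open SetoidReasoning D.setoid

  kernel-sound : ∀ u v → proj₁ u ≋ proj₁ v → ⟦ u ⟧ D.≈ ⟦ v ⟧
  kernel-sound u v (f , (f∈B , hf) , agree) =
    D.trans (D.sym (∧-kernel (f , f∈B) u hf)) (D.trans (cong agree) (∧-kernel (f , f∈B) v hf))

  -- the biimplication of u and v lies in the kernel when h u ≈ h v
  kernel-complete : ∀ u v → ⟦ u ⟧ D.≈ ⟦ v ⟧ → proj₁ u ≋ proj₁ v
  kernel-complete u v e =
    proj₁ u⇔v , (proj₂ u⇔v , h[u⇔v]≈⊤) , agree-⇔ A (proj₁ u) (proj₁ v)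
    where
    u⇔v : B.Carrier
    u⇔v = (u B.⇒ v) B.∧ (v B.⇒ u)

    h⇒≈⊤ : ∀ x y → ⟦ x ⟧ D.≈ ⟦ y ⟧ → ⟦ x B.⇒ y ⟧ D.≈ D.⊤
    h⇒≈⊤ x y exy = D.trans (⇒-homo x y) (D.trans (D.⇒-cong exy D.refl) (⇒-diag D ⟦ y ⟧))

    h[u⇔v]≈⊤ : ⟦ u⇔v ⟧ D.≈ D.⊤
    h[u⇔v]≈⊤ = D.trans (∧-homo _ _)
      (D.trans (D.∧-cong (h⇒≈⊤ u v e) (h⇒≈⊤ v u (D.sym e))) (D.⊤-max D.⊤))

module _ {cx ℓx cy ℓy cd ℓd} {X : Brouwerian cx ℓx} {Y : Brouwerian cy ℓy} {D : Brouwerian cd ℓd} where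
  private
    module X = Brouwerian X
    module Y = Brouwerian Y
    module D = Brouwerian D

  sameKernel⇒iso : (h : BrouwerianHomImage X D) (g : BrouwerianHomImage X Y)
    → (let H = BrouwerianHom.⟦_⟧ (BrouwerianHomImage.hom h)
           G = BrouwerianHom.⟦_⟧ (BrouwerianHomImage.hom g))
    → (∀ u v → G u Y.≈ G v → H u D.≈ H v)
    → (∀ u v → H u D.≈ H v → G u Y.≈ G v)
    → BrouwerianIso D Y
  sameKernel⇒iso h g G⇒H H⇒G = record
    { hom = record
      { ⟦_⟧    = Φ
      ; cong   = Φ-cong
      ; ∧-homo = preserves D._∧_ X._∧_ Y._∧_ D.∧-cong h.∧-homo g.∧-homo
      ; ∨-homo = preserves D._∨_ X._∨_ Y._∨_ D.∨-cong h.∨-homo g.∨-homo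
      ; ⇒-homo = preserves D._⇒_ X._⇒_ Y._⇒_ D.⇒-cong h.⇒-homo g.⇒-homo
      ; ⊤-homo = Y.trans (Φ-cong (D.sym h.⊤-homo)) (Y.trans (Φ∘H X.⊤) g.⊤-homo)
      }
    ; injective  = λ {y} {z} e →
        D.trans (D.sym (pre-spec y)) (D.trans (G⇒H _ _ e) (pre-spec z))
    ; surjective = λ w → let (u , gu≈w) = BrouwerianHomImage.surjective g w
                         in h.⟦ u ⟧ , Y.trans (Φ∘H u) gu≈w
    }
    where
    module h = BrouwerianHom (BrouwerianHomImage.hom h)
    module g = BrouwerianHom (BrouwerianHomImage.hom g)

    pre : D.Carrier → X.Carrier
    pre y = proj₁ (BrouwerianHomImage.surjective h y)

    pre-spec : ∀ y → h.⟦ pre y ⟧ D.≈ y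
    pre-spec y = proj₂ (BrouwerianHomImage.surjective h y)

    Φ : D.Carrier → Y.Carrier
    Φ y = g.⟦ pre y ⟧

    Φ-cong : ∀ {y z} → y D.≈ z → Φ y Y.≈ Φ z
    Φ-cong {y} {z} e = H⇒G _ _ (D.trans (pre-spec y) (D.trans e (D.sym (pre-spec z))))

    Φ∘H : ∀ u → Φ h.⟦ u ⟧ Y.≈ g.⟦ u ⟧
    Φ∘H u = H⇒G _ _ (pre-spec h.⟦ u ⟧)

    preserves : (_∙D_ : Op₂ D.Carrier) (_∙X_ : Op₂ X.Carrier) (_∙Y_ : Op₂ Y.Carrier)
      → (∀ {y y′ z z′} → y D.≈ y′ → z D.≈ z′ → (y ∙D z) D.≈ (y′ ∙D z′))
      → (∀ u v → h.⟦ u ∙X v ⟧ D.≈ (h.⟦ u ⟧ ∙D h.⟦ v ⟧))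
      → (∀ u v → g.⟦ u ∙X v ⟧ Y.≈ (g.⟦ u ⟧ ∙Y g.⟦ v ⟧))
      → ∀ y z → Φ (y ∙D z) Y.≈ (Φ y ∙Y Φ z)
    preserves _∙D_ _∙X_ _∙Y_ ∙D-cong h-homo g-homo y z = begin
      Φ (y ∙D z)                          ≈⟨ Φ-cong (∙D-cong (D.sym (pre-spec y)) (D.sym (pre-spec z))) ⟩
      Φ (h.⟦ pre y ⟧ ∙D h.⟦ pre z ⟧)      ≈⟨ Φ-cong (D.sym (h-homo (pre y) (pre z))) ⟩
      Φ h.⟦ pre y ∙X pre z ⟧              ≈⟨ Φ∘H (pre y ∙X pre z) ⟩
      g.⟦ pre y ∙X pre z ⟧                ≈⟨ g-homo (pre y) (pre z) ⟩
      Φ y ∙Y Φ z                          ∎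
      where open SetoidReasoning Y.setoid

mainTheorem4 : ∀ {a ℓ p d ℓd} (A : Heyting a ℓ) (B : Subalgebra (A ⁺) p)
    → (D : Brouwerian d ℓd) → BrouwerianHomImage ⟪ B ⟫ D
    → Σ[ C ∈ Heyting (a ⊔ ℓ ⊔ p ⊔ d ⊔ ℓd) (a ⊔ ℓ ⊔ p ⊔ d ⊔ ℓd) ]
    Σ[ _ ∈ HeytingHomImage A C ]
    Σ[ S ∈ Subalgebra (C ⁺) (a ⊔ ℓ ⊔ p ⊔ d ⊔ ℓd) ]
    BrouwerianIso D ⟪ S ⟫
mainTheorem4 {a} {ℓ} {p} {d} {ℓd} A B D h =
  A/θ , projection , image B ,
  sameKernel⇒iso h (π↾ B) (λ u v e → kernel-sound u v (lower e))
                          (λ u v e → lift (kernel-complete u v e))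
  where
  open Kernel B (BrouwerianHomImage.hom h)
  open HeytingQuotient A θ (a ⊔ ℓ ⊔ p ⊔ d ⊔ ℓd)
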